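{- Let $X$ be a strongly regular graph with parameters $(n,k,a,c)$ (as defined in the context), whose eigenvalues $\lambda_1>\lambda_2$ other than $k$ are integers, and write $e=\lambda_1$ (so $e\ge 1$, $\lambda_2=a-c-e$ and $k=(e+1)c+e(e-a)$). Define the Krein parameter $$K_2=(k+\lambda_2)(\lambda_1+1)^2-(\lambda_2+1)(k+\lambda_2+2\lambda_1\lambda_2).$$ If $K_2\ge 0$, then $$c\le\begin{cases} e^2+e+2a & \text{if } e\ge 3,\\ e^2+e+3a & \text{if } e=1,2.\end{cases}$$ In particular, when $a=0$ we have $c\le e(e+1)$.
   Context: A graph $X$ is a strongly regular graph with parameters $(n,k,a,c)$ if it is a connected, non-bipartite graph on $n$ vertices which is regular of degree $k$, any two adjacent vertices have exactly $a$ common neighbours, any two distinct non-adjacent vertices have exactly $c$ common neighbours, and $k\ge 3$, $k>c\ge 1$. Its adjacency matrix has eigenvalue $k$ and the two roots $\lambda_1>\lambda_2$ of $\lambda^2-(a-c)\lambda-(k-c)=0$. -}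

module Defs where

open import Data.Nat using (ℕ; zero; suc; _≤_; _<_)
open import Data.Bool using (Bool; true; false; if_then_else_; _∧_)
open import Data.Fin using (Fin)
import Data.Fin as F
open import Data.Product using (Σ; _×_)
open import Relation.Binary.PropositionalEquality using (_≡_; _≢_)
open import Relation.Binary.Construct.Closure.ReflexiveTransitive using (Star)
open import Relation.Nullary using (¬_)
open import Function using (_∘_)
open import Data.Integer as Int using (ℤ; +_)

count : ∀ {n} → (Fin n → Bool) → ℕ
count {zero}  p = 0
count {suc n} p = (if p F.zero then 1 else 0) + count (p ∘ F.suc)
  where open Data.Nat using (_+_)

record Graph (n : ℕ) : Set where
  field
    adj     : Fin n → Fin n → Bool
    adj-sym : ∀ u v → adj u v ≡ adj v u
    loopless : ∀ v → adj v v ≡ false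

module _ {n : ℕ} (G : Graph n) where
  open Graph G

  Adj : Fin n → Fin n → Set
  Adj u v = adj u v ≡ true

  degree : Fin n → ℕ
  degree v = count (adj v)

  commonNeighbours : Fin n → Fin n → ℕ
  commonNeighbours u v = count (λ w → adj u w ∧ adj v w)

  Connected : Set
  Connected = ∀ u v → Star Adj u v

  Bipartite : Set
  Bipartite = Σ (Fin n → Bool) λ col → ∀ u v → Adj u v → col u ≢ col v

  record IsSRG (k a c : ℕ) : Set where
    field
      connected     : Connected
      nonBipartite  : ¬ Bipartite
      regular       : ∀ v → degree v ≡ k
      adjCommon     : ∀ u v → Adj u v → commonNeighbours u v ≡ a
      nonAdjCommon  : ∀ u v → u ≢ v → ¬ Adj u v → commonNeighbours u v ≡ c
      k≥3           : 3 ≤ k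
      c<k           : c < k
      c≥1           : 1 ≤ c

K₂ : (k λ₁ λ₂ : ℤ) → ℤ
K₂ k λ₁ λ₂ = (k + λ₂) * ((λ₁ + + 1) * (λ₁ + + 1))
             - (λ₂ + + 1) * (k + λ₂ + + 2 * λ₁ * λ₂)
  where open Int using (_+_; _*_; _-_)

-- Write λ₂ = a − c − e and y = c − (e² + e + a).  Eliminating k with the root
-- equation, the Krein parameter becomes  K₂ = a (y + 2e(e+2)) − y e (e(e+2) + y − 1).
-- If c exceeded e² + e + (1+d)a, i.e. y > d a, with d e ≥ 2, the negative term
-- would dominate and K₂ < 0.  The cases d = 1 (e ≥ 2) and d = 2 (e ≥ 1) give the
-- two bounds, and a = 0 gives c ≤ e(e+1).  That e ≥ 1 follows from
-- e λ₂ = c − k < 0 and λ₂ < e.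
module Submission where

open import Defs
open import Data.Nat using (ℕ)
open import Data.Integer using (ℤ; +_; _+_; _-_; _*_; _≤_; _<_)
open import Data.Product using (_×_)
open import Data.Sum using (_⊎_)
open import Relation.Binary.PropositionalEquality using (_≡_)

import Data.Nat as ℕ
import Data.Nat.Properties as ℕ
import Data.Nat.Tactic.RingSolver as ℕ-Solver
open import Data.Integer using (-_; -[1+_]; +≤+; +<+)
open import Data.Integer.Properties
  using (pos-*; +-identityʳ; +-inverseʳ; +-monoˡ-≤; +-monoˡ-<; _≤?_; ≰⇒>; <⇒≱; i<j⇒suc[i]≤j; module ≤-Reasoning)
open import Data.Integer.Tactic.RingSolver using (solve-∀)
open import Data.Product using (_,_)
open import Relation.Nullary using (yes; no; contradiction)
open import Relation.Binary.PropositionalEquality using (refl; sym; trans; cong; subst; subst₂; module ≡-Reasoning)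

i<j⇒i-j<0 : ∀ {i j : ℤ} → i < j → i - j < + 0
i<j⇒i-j<0 {i} {j} i<j = subst (i - j <_) (+-inverseʳ j) (+-monoˡ-< (- j) i<j)

j<i⇒i*j<0⇒0<i : ∀ {i j : ℤ} → j < i → i * j < + 0 → + 0 < i
j<i⇒i*j<0⇒0<i {+ ℕ.suc n}          _  _          = +<+ (ℕ.s≤s ℕ.z≤n)
j<i⇒i*j<0⇒0<i {+ 0}                _  (+<+ ())
j<i⇒i*j<0⇒0<i { -[1+ m ]} { -[1+ n ]} _ (+<+ ())
j<i⇒i*j<0⇒0<i { -[1+ m ]} {+ n}    ()

root⇒k≡ : ∀ (k a c e : ℤ) → e * e - (a - c) * e - (k - c) ≡ + 0 → k ≡ c + e * (e + c - a)
root⇒k≡ k a c e root = begin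
  k                                                        ≡⟨ identity k a c e ⟩
  c + e * (e + c - a) - (e * e - (a - c) * e - (k - c))    ≡⟨ cong (λ z → c + e * (e + c - a) - z) root ⟩
  c + e * (e + c - a) + + 0                                ≡⟨ +-identityʳ _ ⟩
  c + e * (e + c - a)                                      ∎
  where
  open ≡-Reasoning
  identity : ∀ k a c e → k ≡ c + e * (e + c - a) - (e * e - (a - c) * e - (k - c))
  identity = solve-∀

root⇒c-k≡ : ∀ (k a c e : ℤ) → e * e - (a - c) * e - (k - c) ≡ + 0 → c - k ≡ e * (a - c - e)
root⇒c-k≡ k a c e root = trans (cong (λ z → c - z) (root⇒k≡ k a c e root)) (identity a c e)
  where
  identity : ∀ a c e → c - (c + e * (e + c - a)) ≡ e * (a - c - e)
  identity = solve-∀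

-- Here x = y − 1.  The helper spells out K₂, which the solver cannot unfold.
krein-closed-form : ∀ (c e a : ℤ) → let x = c - (e * e + e + a) - + 1 in
  K₂ (c + e * (e + c - a)) e (a - c - e)
    ≡ a * (+ 1 + x + + 2 * (e * (e + + 2))) - (+ 1 + x) * (e * (e * (e + + 2) + x))
krein-closed-form = expanded
  where
  expanded : ∀ (c e a : ℤ) →
    let x = c - (e * e + e + a) - + 1; k = c + e * (e + c - a); s = a - c - e in
    (k + s) * ((e + + 1) * (e + + 1)) - (s + + 1) * (k + s + + 2 * e * s)
      ≡ a * (+ 1 + x + + 2 * (e * (e + + 2))) - (+ 1 + x) * (e * (e * (e + + 2) + x))
  expanded = solve-∀

krein-dominance : ∀ d e a x → 2 ℕ.≤ d ℕ.* e → d ℕ.* a ℕ.≤ x →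
  a ℕ.* (ℕ.suc x ℕ.+ 2 ℕ.* (e ℕ.* (e ℕ.+ 2)))
    ℕ.< ℕ.suc x ℕ.* (e ℕ.* (e ℕ.* (e ℕ.+ 2) ℕ.+ x))
krein-dominance d 0 a x 2≤d*0 _ = contradiction (ℕ.≤-trans 2≤d*0 (ℕ.≤-reflexive (ℕ.*-zeroʳ d))) λ ()
krein-dominance d e@(ℕ.suc _) a x 2≤de da≤x = begin-strict
  a ℕ.* (ℕ.suc x ℕ.+ 2 ℕ.* m)                    ≡⟨ ℕ.*-distribˡ-+ a (ℕ.suc x) (2 ℕ.* m) ⟩
  a ℕ.* ℕ.suc x ℕ.+ a ℕ.* (2 ℕ.* m)              <⟨ ℕ.+-mono-≤-< linear-part quadratic-part ⟩
  ℕ.suc x ℕ.* (e ℕ.* x) ℕ.+ ℕ.suc x ℕ.* (e ℕ.* m) ≡⟨ regroup (ℕ.suc x) e m x ⟩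
  ℕ.suc x ℕ.* (e ℕ.* (m ℕ.+ x))                  ∎
  where
  open ℕ.≤-Reasoning
  m : ℕ
  m = e ℕ.* (e ℕ.+ 2)

  a≤e*x : a ℕ.≤ e ℕ.* x
  a≤e*x = begin
    a                  ≤⟨ ℕ.m≤m+n a (a ℕ.+ 0) ⟩
    2 ℕ.* a            ≤⟨ ℕ.*-monoˡ-≤ a 2≤de ⟩
    d ℕ.* e ℕ.* a      ≡⟨ swap d e a ⟩
    e ℕ.* (d ℕ.* a)    ≤⟨ ℕ.*-monoʳ-≤ e da≤x ⟩
    e ℕ.* x            ∎
    where
    swap : ∀ d e a → d ℕ.* e ℕ.* a ≡ e ℕ.* (d ℕ.* a)
    swap = ℕ-Solver.solve-∀

  linear-part : a ℕ.* ℕ.suc x ℕ.≤ ℕ.suc x ℕ.* (e ℕ.* x)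
  linear-part = ℕ.≤-trans (ℕ.*-monoˡ-≤ (ℕ.suc x) a≤e*x) (ℕ.≤-reflexive (ℕ.*-comm (e ℕ.* x) (ℕ.suc x)))

  quadratic-part : a ℕ.* (2 ℕ.* m) ℕ.< ℕ.suc x ℕ.* (e ℕ.* m)
  quadratic-part = begin-strict
    a ℕ.* (2 ℕ.* m)            ≤⟨ ℕ.*-monoʳ-≤ a (ℕ.*-monoˡ-≤ m 2≤de) ⟩
    a ℕ.* (d ℕ.* e ℕ.* m)      ≡⟨ reassociate a d e m ⟩
    d ℕ.* a ℕ.* (e ℕ.* m)      ≤⟨ ℕ.*-monoˡ-≤ (e ℕ.* m) da≤x ⟩
    x ℕ.* (e ℕ.* m)            <⟨ ℕ.*-monoˡ-< (e ℕ.* m) (ℕ.n<1+n x) ⟩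
    ℕ.suc x ℕ.* (e ℕ.* m)      ∎
    where
    reassociate : ∀ a d e m → a ℕ.* (d ℕ.* e ℕ.* m) ≡ d ℕ.* a ℕ.* (e ℕ.* m)
    reassociate = ℕ-Solver.solve-∀

  regroup : ∀ y e m x → y ℕ.* (e ℕ.* x) ℕ.+ y ℕ.* (e ℕ.* m) ≡ y ℕ.* (e ℕ.* (m ℕ.+ x))
  regroup = ℕ-Solver.solve-∀

krein-dominanceℤ : ∀ d e a (x : ℤ) → 2 ℕ.≤ d ℕ.* e → + (d ℕ.* a) ≤ x →
  + a * (+ 1 + x + + 2 * (+ e * (+ e + + 2))) < (+ 1 + x) * (+ e * (+ e * (+ e + + 2) + x))
krein-dominanceℤ d e a (+ x) 2≤de (+≤+ da≤x) =
  subst₂ _<_ lhs rhs (+<+ (krein-dominance d e a x 2≤de da≤x))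
  where
  lhs : + (a ℕ.* (ℕ.suc x ℕ.+ 2 ℕ.* (e ℕ.* (e ℕ.+ 2)))) ≡ + a * (+ 1 + + x + + 2 * (+ e * (+ e + + 2)))
  lhs = trans (pos-* a (ℕ.suc x ℕ.+ 2 ℕ.* (e ℕ.* (e ℕ.+ 2))))
          (cong (λ z → + a * (+ ℕ.suc x + z)) (trans (pos-* 2 (e ℕ.* (e ℕ.+ 2))) (cong (+ 2 *_) (pos-* e (e ℕ.+ 2)))))
  rhs : + (ℕ.suc x ℕ.* (e ℕ.* (e ℕ.* (e ℕ.+ 2) ℕ.+ x))) ≡ (+ 1 + + x) * (+ e * (+ e * (+ e + + 2) + + x))
  rhs = trans (pos-* (ℕ.suc x) (e ℕ.* (e ℕ.* (e ℕ.+ 2) ℕ.+ x)))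
          (cong (+ ℕ.suc x *_) (trans (pos-* e (e ℕ.* (e ℕ.+ 2) ℕ.+ x)) (cong (λ z → + e * (z + + x)) (pos-* e (e ℕ.+ 2)))))

krein-bound : ∀ d {k a c} e → 2 ℕ.≤ d ℕ.* e →
  + e * + e - (+ a - + c) * + e - (+ k - + c) ≡ + 0 →
  + 0 ≤ K₂ (+ k) (+ e) (+ a - + c - + e) →
  + c ≤ + e * + e + + e + + ℕ.suc d * + a
krein-bound d {k} {a} {c} e 2≤de root K₂≥0 with + c ≤? + e * + e + + e + + ℕ.suc d * + a
... | yes c≤bound = c≤bound
... | no  c≰bound = contradiction K₂≥0 (<⇒≱ K₂<0)
  where
  open ≤-Reasoning
  E A C x : ℤ
  E = + e
  A = + a
  C = + c
  x = C - (E * E + E + A) - + 1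

  da≤x : + (d ℕ.* a) ≤ x
  da≤x = begin
    + (d ℕ.* a)                                              ≡⟨ trans (pos-* d a) (excess (+ d) E A) ⟩
    + 1 + (E * E + E + + ℕ.suc d * A) - (E * E + E + A) - + 1 ≤⟨ +-monoˡ-≤ (- + 1) (+-monoˡ-≤ _ (i<j⇒suc[i]≤j (≰⇒> c≰bound))) ⟩
    x                                                        ∎
    where
    excess : ∀ D E A → D * A ≡ + 1 + (E * E + E + (+ 1 + D) * A) - (E * E + E + A) - + 1
    excess = solve-∀

  K₂<0 : K₂ (+ k) E (A - C - E) < + 0
  K₂<0 = begin-strict
    K₂ (+ k) E (A - C - E)                   ≡⟨ cong (λ k → K₂ k E (A - C - E)) (root⇒k≡ (+ k) A C E root) ⟩
    K₂ (C + E * (E + C - A)) E (A - C - E)   ≡⟨ krein-closed-form C E A ⟩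
    _                                        <⟨ i<j⇒i-j<0 (krein-dominanceℤ d e a x 2≤de da≤x) ⟩
    + 0                                      ∎

larger-root-positive : ∀ {k a c} e → c ℕ.< k →
  e * e - (+ a - + c) * e - (+ k - + c) ≡ + 0 → (+ a - + c - e) < e → + 0 < e
larger-root-positive {k} {a} {c} e c<k root λ₂<e =
  j<i⇒i*j<0⇒0<i λ₂<e (subst (_< + 0) (root⇒c-k≡ (+ k) (+ a) (+ c) e root) (i<j⇒i-j<0 (+<+ c<k)))

theorem2p1 : (n k a c : ℕ) (X : Graph n) → IsSRG X k a c →
    (e : ℤ) →
    e * e - (+ a - + c) * e - (+ k - + c) ≡ + 0 →
    (+ a - + c - e) < e →
    + 0 ≤ K₂ (+ k) e (+ a - + c - e) →
    ((+ 3 ≤ e → + c ≤ e * e + e + + 2 * + a)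
     × ((e ≡ + 1 ⊎ e ≡ + 2) → + c ≤ e * e + e + + 3 * + a)
     × (a ≡ 0 → + c ≤ e * (e + + 1)))
theorem2p1 _ k a c _ srg e root λ₂<e K₂≥0 with larger-root-positive e (IsSRG.c<k srg) root λ₂<e
... | +<+ {n = e} 0<e = large , (λ _ → bound₃) , triangle-free
  where
  large : + 3 ≤ + e → + c ≤ + e * + e + + e + + 2 * + a
  large (+≤+ 3≤e) = krein-bound 1 e 2≤1*e root K₂≥0
    where
    2≤1*e : 2 ℕ.≤ 1 ℕ.* e
    2≤1*e = subst (2 ℕ.≤_) (sym (ℕ.*-identityˡ e)) (ℕ.≤-trans (ℕ.n≤1+n 2) 3≤e)

  -- holds for every e ≥ 1
  bound₃ : + c ≤ + e * + e + + e + + 3 * + a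
  bound₃ = krein-bound 2 e (ℕ.*-monoʳ-≤ 2 0<e) root K₂≥0

  triangle-free : a ≡ 0 → + c ≤ + e * (+ e + + 1)
  triangle-free refl = subst (+ c ≤_) (square-plus-self (+ e)) bound₃
    where
    square-plus-self : ∀ e → e * e + e + + 0 ≡ e * (e + + 1)
    square-plus-self = solve-∀
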